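{- Let $n\ge2$, let $\lambda$ be a proper permutation, and let $g$ be an embedding into $\pi_n$ of some permutation $\tau$ with $\lambda\le\tau\le\pi_n$. Then the rightmost embedding of $\lambda$ in $g$ is greedy or almost greedy in $g$. Moreover, if the rightmost embedding of $\lambda$ in $g$ is almost greedy in $g$, then every embedding $f'$ of $\lambda$ into $\pi_n$ compatible with $g$ satisfies $1\in\mathrm{Img}(f')$ and hence $2n+2\notin\mathrm{Img}(f')$, and there is no embedding of $\lambda$ that is greedy in $g$.
   Context: Permutations of size $m$ are bijections of $[m]$ written as value sequences. An embedding of $\sigma\in\mathcal{S}_k$ into $\pi\in\mathcal{S}_N$ is a strictly increasing $f\colon[k]\to[N]$ with $\pi(f(1)),\dots,\pi(f(k))$ order-isomorphic to $\sigma$; $\mathrm{Img}(f)$ is its image (an embedding into $\pi$ is determined by its image); $\sigma\le\pi$ iff one exists. For $n\ge1$, $\pi_n\in\mathcal{S}_{2n+2}$ is given by $\pi_n(1)=n+1$, $\pi_n(2i)=i$ and $\pi_n(2i+1)=n+2+i$ for $1\le i\le n$, $\pi_n(2n+2)=n+2$. Position $1$ of $\pi_n$ is its left position, $2n+2$ its right position, $2,4,\dots,2n$ its bottom positions and $3,5,\dots,2n+1$ its top positions. An inverse descent of $\lambda$ is a pair $i<j$ with $\lambda(i)=\lambda(j)+1$. If $\lambda$ has exactly one inverse descent, at $i<j$, then $k$ is a top position of $\lambda$ if $\lambda(k)\ge\lambda(i)$ and a bottom position if $\lambda(k)\le\lambda(j)$; a top (bottom) repetition is a pair of consecutive positions both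 top (bottom). A permutation $\lambda$ with $21\le\lambda<\pi_n$ of size $m$ is proper if: (1) it has exactly one inverse descent; (2) positions $1$ and $m-1$ are top positions and $2$ and $m$ are bottom positions of $\lambda$ (for $m=2$, $\lambda=21$); (3) it has at most one top repetition and at most one bottom repetition, and if both, the top repetition is to the left of the bottom one. An embedding $f$ of $\lambda$ is compatible with $g$ if $\mathrm{Img}(f)\subseteq\mathrm{Img}(g)$. Lexicographic order: $f'<_L f$ if at the smallest $i$ with $f(i)\ne f'(i)$ we have $f'(i)<f(i)$; the rightmost embedding of $\lambda$ in $g$ is the $<_L$-largest embedding of $\lambda$ compatible with $g$. An embedding $f$ of $\lambda$ (size $m$) is greedy in $g$ if: $f(m)$ is the largest bottom or right position of $\pi_n$ in $\mathrm{Img}(g)$; for each top position $i\in[m-1]$ of $\lambda$, $f(i)$ is the largest left or top position $j\in\mathrm{Img}(g)$ with $j<f(i+1)$; and for each bottom position $i\in[m-1]$ of $\lambda$, $f(i)$ is the largest bottom position $j\in\mathrm{Img}(g)$ with $j<f(i+1)$. An embedding $f$ of $\lambda$ is almost greedy in $g$ if $2n+2\in\mathrm{Img}(g)$ and $f$ is greedy in the embedding $g^-$ into $\pi_n$ with $\mathrm{Img}(g^-)=\mathrm{Img}(g)\setminus\{2n+2\}$. -}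

module Defs where

open import Data.Nat using (ℕ; zero; suc; _+_; _*_; _∸_; _≤_; _<_; _≡ᵇ_; _/_; _%_)
open import Data.Bool using (if_then_else_)
open import Data.Product using (Σ; _×_)
open import Data.Sum using (_⊎_)
open import Relation.Nullary using (¬_)
open import Relation.Binary.PropositionalEquality using (_≡_; _≢_)

-- Conventions: positions and values are 1-indexed natural numbers, as in
-- the paper.  A (raw) permutation of size m is a function σ : ℕ → ℕ of
-- which only the values σ 1, …, σ m matter; an embedding is likewise a
-- function f : ℕ → ℕ of which only f 1, …, f k matter.

IsPerm : ℕ → (ℕ → ℕ) → Set
IsPerm m σ =
  (∀ i → 1 ≤ i → i ≤ m → 1 ≤ σ i × σ i ≤ m) ×
  (∀ i j → 1 ≤ i → i ≤ m → 1 ≤ j → j ≤ m → σ i ≡ σ j → i ≡ j) ×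
  (∀ v → 1 ≤ v → v ≤ m → Σ ℕ λ i → 1 ≤ i × i ≤ m × σ i ≡ v)

IsEmbedding : ℕ → (ℕ → ℕ) → ℕ → (ℕ → ℕ) → (ℕ → ℕ) → Set
IsEmbedding k σ N π f =
  (∀ i → 1 ≤ i → i ≤ k → 1 ≤ f i × f i ≤ N) ×
  (∀ i j → 1 ≤ i → i < j → j ≤ k → f i < f j) ×
  (∀ i j → 1 ≤ i → i ≤ k → 1 ≤ j → j ≤ k →
     (σ i < σ j → π (f i) < π (f j)) × (π (f i) < π (f j) → σ i < σ j))

Contained : ℕ → (ℕ → ℕ) → ℕ → (ℕ → ℕ) → Set
Contained k σ N π = Σ (ℕ → ℕ) λ f → IsEmbedding k σ N π f

SamePerm : ℕ → (ℕ → ℕ) → ℕ → (ℕ → ℕ) → Set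
SamePerm k σ N π = k ≡ N × (∀ i → 1 ≤ i → i ≤ k → σ i ≡ π i)

StrictlyContained : ℕ → (ℕ → ℕ) → ℕ → (ℕ → ℕ) → Set
StrictlyContained k σ N π = Contained k σ N π × ¬ SamePerm k σ N π

Img : ℕ → (ℕ → ℕ) → ℕ → Set
Img k f x = Σ ℕ λ i → 1 ≤ i × i ≤ k × f i ≡ x

Compatible : ℕ → (ℕ → ℕ) → ℕ → (ℕ → ℕ) → Set
Compatible k f t g = ∀ x → Img k f x → Img t g x

twentyOne : ℕ → ℕ
twentyOne 1 = 2
twentyOne _ = 1

πsize : ℕ → ℕ
πsize n = 2 * n + 2

πval : ℕ → ℕ → ℕ
πval n p =
  if p ≡ᵇ 1 then n + 1
  else if p ≡ᵇ πsize n then n + 2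
  else if p % 2 ≡ᵇ 0 then p / 2
  else n + 2 + (p ∸ 1) / 2

LeftPos : ℕ → Set
LeftPos p = p ≡ 1

RightPos : ℕ → ℕ → Set
RightPos n p = p ≡ πsize n

BottomPos : ℕ → ℕ → Set
BottomPos n p = Σ ℕ λ i → 1 ≤ i × i ≤ n × p ≡ 2 * i

TopPos : ℕ → ℕ → Set
TopPos n p = Σ ℕ λ i → 1 ≤ i × i ≤ n × p ≡ 2 * i + 1

InvDescent : ℕ → (ℕ → ℕ) → ℕ → ℕ → Set
InvDescent m σ i j = 1 ≤ i × i < j × j ≤ m × σ i ≡ suc (σ j)

ExactlyOneInvDescent : ℕ → (ℕ → ℕ) → Set
ExactlyOneInvDescent m σ =
  Σ ℕ λ i → Σ ℕ λ j → InvDescent m σ i j ×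
    (∀ i' j' → InvDescent m σ i' j' → i' ≡ i × j' ≡ j)

-- top / bottom positions of σ (meaningful when σ has exactly one inverse descent)
TopPosOf : ℕ → (ℕ → ℕ) → ℕ → Set
TopPosOf m σ k = 1 ≤ k × k ≤ m ×
  (Σ ℕ λ i → Σ ℕ λ j → InvDescent m σ i j × σ i ≤ σ k)

BotPosOf : ℕ → (ℕ → ℕ) → ℕ → Set
BotPosOf m σ k = 1 ≤ k × k ≤ m ×
  (Σ ℕ λ i → Σ ℕ λ j → InvDescent m σ i j × σ k ≤ σ j)

TopRep : ℕ → (ℕ → ℕ) → ℕ → Set
TopRep m σ k = TopPosOf m σ k × TopPosOf m σ (suc k)

BotRep : ℕ → (ℕ → ℕ) → ℕ → Set
BotRep m σ k = BotPosOf m σ k × BotPosOf m σ (suc k)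

Proper : ℕ → ℕ → (ℕ → ℕ) → Set
Proper n m σ =
  IsPerm m σ ×
  Contained 2 twentyOne m σ ×
  StrictlyContained m σ (πsize n) (πval n) ×
  ExactlyOneInvDescent m σ ×
  (TopPosOf m σ 1 × TopPosOf m σ (m ∸ 1) × BotPosOf m σ 2 × BotPosOf m σ m) ×
  (∀ k k' → TopRep m σ k → TopRep m σ k' → k ≡ k') ×
  (∀ k k' → BotRep m σ k → BotRep m σ k' → k ≡ k') ×
  (∀ k k' → TopRep m σ k → BotRep m σ k' → k < k')

LexLess : ℕ → (ℕ → ℕ) → (ℕ → ℕ) → Set
LexLess k f' f = Σ ℕ λ i → 1 ≤ i × i ≤ k ×
  (∀ j → 1 ≤ j → j < i → f' j ≡ f j) × f' i < f i

Rightmost : ℕ → ℕ → (ℕ → ℕ) → ℕ → (ℕ → ℕ) → (ℕ → ℕ) → Set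
Rightmost n m σ t g f =
  IsEmbedding m σ (πsize n) (πval n) f × Compatible m f t g ×
  (∀ f' → IsEmbedding m σ (πsize n) (πval n) f' → Compatible m f' t g →
     LexLess m f' f ⊎ (∀ i → 1 ≤ i → i ≤ m → f' i ≡ f i))

IsLargest : (ℕ → Set) → ℕ → Set
IsLargest P x = P x × (∀ y → P y → y ≤ x)

GreedyIn : ℕ → ℕ → (ℕ → ℕ) → (ℕ → Set) → (ℕ → ℕ) → Set
GreedyIn n m σ S f =
  IsLargest (λ j → (BottomPos n j ⊎ RightPos n j) × S j) (f m) ×
  (∀ i → 1 ≤ i → i ≤ m ∸ 1 → TopPosOf m σ i →
     IsLargest (λ j → (LeftPos j ⊎ TopPos n j) × S j × j < f (suc i)) (f i)) ×
  (∀ i → 1 ≤ i → i ≤ m ∸ 1 → BotPosOf m σ i →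
     IsLargest (λ j → BottomPos n j × S j × j < f (suc i)) (f i))

Greedy : ℕ → ℕ → (ℕ → ℕ) → ℕ → (ℕ → ℕ) → (ℕ → ℕ) → Set
Greedy n m σ t g f = GreedyIn n m σ (Img t g) f

AlmostGreedy : ℕ → ℕ → (ℕ → ℕ) → ℕ → (ℕ → ℕ) → (ℕ → ℕ) → Set
AlmostGreedy n m σ t g f =
  Img t g (πsize n) × GreedyIn n m σ (λ j → Img t g j × j ≢ πsize n) f

-- Any embedding of λ into π_n sends the top positions of λ to left or top
-- positions of π_n and its bottom positions to bottom positions, except that the
-- last one may go to the right position.  If the rightmost embedding f violated a
-- greedy condition at i, some y ∈ Img(g) of the same kind as f(i) would lie
-- strictly between f(i) and f(i+1).  Within each kind π_n is increasing, so the
-- values between π_n(f(i)) and π_n(y) sit at positions strictly between f(i) and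
-- y, which f does not use; the one exception is the value n+2 of the right
-- position 2n+2, lying above the left value n+1, but an embedding of λ cannot use
-- both 1 and 2n+2.  Hence moving f(i) to y would give a compatible embedding that
-- is lexicographically larger than f.  The only move that can fail is f(m) to
-- 2n+2, namely when f uses position 1; then every compatible f′ has
-- f′(1) ≤ f(1) = 1, so f′ uses 1 and not 2n+2, whereas a greedy embedding would
-- have to end at 2n+2.
module Submission where

open import Data.Bool using (true; false; T)
open import Data.Nat
open import Data.Nat.DivMod using (m*n%n≡0; m*n/n≡m; [m+kn]%n≡m%n)
open import Data.Nat.Properties
open import Data.Nat.Tactic.RingSolver using (solve-∀)
open import Data.Product
open import Data.Sum
open import Function using (id)
open import Relation.Binary.Definitions using (tri<; tri≈; tri>)
open import Relation.Binary.PropositionalEquality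
open import Relation.Nullary
open import Relation.Nullary.Decidable using (decidable-stable)

open import Defs

≡ᵇ-true : ∀ m n → m ≡ n → (m ≡ᵇ n) ≡ true
≡ᵇ-true m n m≡n with m ≡ᵇ n in eq
... | true  = refl
... | false = contradiction (≡⇒≡ᵇ m n m≡n) (subst T eq)

≡ᵇ-false : ∀ m n → m ≢ n → (m ≡ᵇ n) ≡ false
≡ᵇ-false m n m≢n with m ≡ᵇ n in eq
... | false = refl
... | true  = contradiction (≡ᵇ⇒≡ m n (subst T (sym eq) _)) m≢n

2a+1≡1+2a : ∀ a → 2 * a + 1 ≡ suc (2 * a)
2a+1≡1+2a = solve-∀

2[1+a]≡2+2a : ∀ a → 2 * suc a ≡ suc (2 * a + 1)
2[1+a]≡2+2a = solve-∀

2n+2≡2[1+n] : ∀ n → 2 * n + 2 ≡ 2 * suc n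
2n+2≡2[1+n] = solve-∀

n+2+a≡2+[n+a] : ∀ n a → n + 2 + a ≡ suc (suc (n + a))
n+2+a≡2+[n+a] = solve-∀

2a≢1 : ∀ a → 2 * a ≢ 1
2a≢1 zero          ()
2a≢1 (suc zero)    ()
2a≢1 (suc (suc a)) ()

2a+1≢1 : ∀ {a} → 1 ≤ a → 2 * a + 1 ≢ 1
2a+1≢1 {suc a} _ eq = 0≢1+n (sym (suc-injective (trans (sym (2a+1≡1+2a (suc a))) eq)))

2a≮1 : ∀ {a} → 1 ≤ a → ¬ 2 * a < 1
2a≮1 {suc a} _ (s≤s ())

2a<πsize : ∀ {a n} → a ≤ n → 2 * a < πsize n
2a<πsize {n = n} a≤n = ≤-<-trans (*-monoʳ-≤ 2 a≤n) (m<m+n (2 * n) z<s)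

2a+1<πsize : ∀ {a n} → a ≤ n → 2 * a + 1 < πsize n
2a+1<πsize {n = n} a≤n = ≤-<-trans (+-monoˡ-≤ 1 (*-monoʳ-≤ 2 a≤n)) (+-monoʳ-< (2 * n) (n<1+n 1))

≤∸1⇒< : ∀ {i m} → 1 ≤ i → i ≤ m ∸ 1 → i < m
≤∸1⇒< {m = zero}  1≤i i≤0 = contradiction (≤-trans 1≤i i≤0) λ ()
≤∸1⇒< {m = suc m} _   i≤m = s≤s i≤m

<⇒≤∸1 : ∀ {i m} → i < m → i ≤ m ∸ 1
<⇒≤∸1 (s≤s i≤m) = i≤m

data EvenOdd : ℕ → Set where
  even : ∀ a → EvenOdd (2 * a)
  odd  : ∀ a → EvenOdd (2 * a + 1)

evenOdd : ∀ x → EvenOdd x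
evenOdd zero = even 0
evenOdd (suc x) with evenOdd x
... | even a = subst EvenOdd (2a+1≡1+2a a) (odd a)
... | odd a  = subst EvenOdd (2[1+a]≡2+2a a) (even (suc a))

data Position (n : ℕ) : ℕ → Set where
  left   : Position n 1
  bottom : ∀ {a} → 1 ≤ a → a ≤ n → Position n (2 * a)
  top    : ∀ {a} → 1 ≤ a → a ≤ n → Position n (2 * a + 1)
  right  : Position n (πsize n)

position : ∀ n {x} → 1 ≤ x → x ≤ πsize n → Position n x
position n {x} 1≤x x≤N with evenOdd x
... | even zero = contradiction 1≤x λ ()
... | odd zero  = left
... | even (suc a) with suc a ≤? n
...   | yes a≤n = bottom z<s a≤n
...   | no  a≰n = subst (Position n) (trans (2n+2≡2[1+n] n) (cong (2 *_) 1+n≡1+a)) right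
  where
  1+n≡1+a : suc n ≡ suc a
  1+n≡1+a = ≤-antisym (≰⇒> a≰n) (*-cancelˡ-≤ 2 (subst (2 * suc a ≤_) (2n+2≡2[1+n] n) x≤N))
position n {x} 1≤x x≤N | odd (suc a) with suc a ≤? n
...   | yes a≤n = top z<s a≤n
...   | no  a≰n = contradiction (subst₂ _≤_ (2a+1≡1+2a (suc a)) (2n+2≡2[1+n] n) x≤N)
                                (<⇒≱ (s≤s (*-monoʳ-≤ 2 (≰⇒> a≰n))))

value : ∀ {n x} → Position n x → ℕ
value {n} left          = suc n
value {n} right         = suc (suc n)
value (bottom {a} _ _)  = a
value {n} (top {a} _ _) = suc (suc (n + a))

πval≡value : ∀ {n x} (p : Position n x) → πval n x ≡ value p
πval≡value {n} left = +-comm n 1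
πval≡value {n} right
  rewrite ≡ᵇ-false (πsize n) 1 (λ eq → 2a≢1 (suc n) (trans (sym (2n+2≡2[1+n] n)) eq))
        | ≡ᵇ-true (πsize n) (πsize n) refl
  = +-comm n 2
πval≡value {n} (bottom {a} _ a≤n)
  rewrite ≡ᵇ-false (2 * a) 1 (2a≢1 a)
        | ≡ᵇ-false (2 * a) (πsize n) (<⇒≢ (2a<πsize a≤n))
        | *-comm 2 a
        | ≡ᵇ-true (a * 2 % 2) 0 (m*n%n≡0 a 2)
  = m*n/n≡m a 2
πval≡value {n} (top {a} 1≤a a≤n)
  rewrite ≡ᵇ-false (2 * a + 1) 1 (2a+1≢1 1≤a)
        | ≡ᵇ-false (2 * a + 1) (πsize n) (<⇒≢ (2a+1<πsize a≤n))
        | 2a+1≡1+2a a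
        | *-comm 2 a
        | ≡ᵇ-false (suc (a * 2) % 2) 0 (λ eq → 0≢1+n (sym (trans (sym ([m+kn]%n≡m%n 1 a 2)) eq)))
  = trans (cong (n + 2 +_) (m*n/n≡m a 2)) (n+2+a≡2+[n+a] n a)

πval-< : ∀ {n x y} (p : Position n x) (q : Position n y) → value p < value q → πval n x < πval n y
πval-< p q = subst₂ _<_ (sym (πval≡value p)) (sym (πval≡value q))

bottom<right : ∀ {a n} → a ≤ n → a < suc (suc n)
bottom<right a≤n = m<n⇒m<1+n (s≤s a≤n)

bottom<top : ∀ {a n} c → a ≤ n → a < suc (suc (n + c))
bottom<top {n = n} c a≤n = ≤-<-trans (≤-trans a≤n (m≤m+n n c)) (m<n⇒m<1+n (n<1+n _))

left<top : ∀ n c → suc n < suc (suc (n + c))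
left<top n c = s≤s (s≤s (m≤m+n n c))

right<top : ∀ n {c} → 1 ≤ c → suc (suc n) < suc (suc (n + c))
right<top n 1≤c = s≤s (s≤s (m<m+n n 1≤c))

top<top : ∀ n {a c} → 2 * a + 1 < 2 * c + 1 → suc (suc (n + a)) < suc (suc (n + c))
top<top n {a} {c} 2a+1<2c+1 =
  s≤s (s≤s (+-monoʳ-< n (*-cancelˡ-< 2 a c (+-cancelʳ-< 1 (2 * a) (2 * c) 2a+1<2c+1))))

leftTop⊎bottomRight : ∀ n {x} → 1 ≤ x → x ≤ πsize n →
                      (LeftPos x ⊎ TopPos n x) ⊎ (BottomPos n x ⊎ RightPos n x)
leftTop⊎bottomRight n 1≤x x≤N with position n 1≤x x≤N
... | left           = inj₁ (inj₁ refl)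
... | top 1≤a a≤n    = inj₁ (inj₂ (_ , 1≤a , a≤n , refl))
... | bottom 1≤a a≤n = inj₂ (inj₁ (_ , 1≤a , a≤n , refl))
... | right          = inj₂ (inj₂ refl)

πval-left<right : ∀ n → πval n 1 < πval n (πsize n)
πval-left<right n = πval-< left right (n<1+n _)

πval-<-from-bottom : ∀ {n p q} → BottomPos n p → p < q → q ≤ πsize n → πval n p < πval n q
πval-<-from-bottom {n} (a , 1≤a , a≤n , refl) p<q q≤N with position n (≤-trans z<s p<q) q≤N
... | left            = contradiction p<q (2a≮1 1≤a)
... | bottom 1≤c c≤n  = πval-< (bottom 1≤a a≤n) (bottom 1≤c c≤n) (*-cancelˡ-< 2 a _ p<q)
... | top {c} 1≤c c≤n = πval-< (bottom 1≤a a≤n) (top 1≤c c≤n) (bottom<top c a≤n)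
... | right           = πval-< (bottom 1≤a a≤n) right (bottom<right a≤n)

πval-<-to-top : ∀ {n p q} → TopPos n q → 1 ≤ p → p < q → πval n p < πval n q
πval-<-to-top {n} (b , 1≤b , b≤n , refl) 1≤p p<q with position n 1≤p (<⇒≤ (<-trans p<q (2a+1<πsize b≤n)))
... | left               = πval-< left (top 1≤b b≤n) (left<top n b)
... | bottom {c} 1≤c c≤n = πval-< (bottom 1≤c c≤n) (top 1≤b b≤n) (bottom<top b c≤n)
... | top 1≤c c≤n        = πval-< (top 1≤c c≤n) (top 1≤b b≤n) (top<top n p<q)
... | right              = contradiction (2a+1<πsize b≤n) (<⇒≯ p<q)

πval-bottom<leftTop : ∀ {n p a} → 1 ≤ a → a ≤ n → LeftPos p ⊎ TopPos n p → πval n (2 * a) < πval n p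
πval-bottom<leftTop 1≤a a≤n (inj₁ refl) = πval-< (bottom 1≤a a≤n) left (s≤s a≤n)
πval-bottom<leftTop 1≤a a≤n (inj₂ (c , 1≤c , c≤n , refl)) =
  πval-< (bottom 1≤a a≤n) (top 1≤c c≤n) (bottom<top c a≤n)

top-gap : ∀ {n p q x} → LeftPos p ⊎ TopPos n p → TopPos n q → 1 ≤ x → x ≤ πsize n →
          x < p ⊎ q < x → ¬ (p ≡ 1 × x ≡ πsize n) →
          πval n x < πval n p ⊎ πval n q < πval n x
top-gap (inj₁ refl)  _ 1≤x _ (inj₁ x<1) _ = contradiction x<1 (≤⇒≯ 1≤x)
top-gap (inj₂ p-top) _ 1≤x _ (inj₁ x<p) _ = inj₁ (πval-<-to-top p-top 1≤x x<p)
top-gap {n} p-kind (b , _ , _ , refl) 1≤x x≤N (inj₂ q<x) ¬left-right with position n 1≤x x≤N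
... | left           = contradiction q<x (≤⇒≯ (m≤n+m 1 (2 * b)))
... | top 1≤c c≤n    = inj₂ (πval-<-to-top (_ , 1≤c , c≤n , refl) (m≤n+m 1 (2 * b)) q<x)
... | bottom 1≤c c≤n = inj₁ (πval-bottom<leftTop 1≤c c≤n p-kind)
... | right with p-kind
...   | inj₁ refl                   = contradiction (refl , refl) ¬left-right
...   | inj₂ (a , 1≤a , a≤n , refl) = inj₁ (πval-< right (top 1≤a a≤n) (right<top n 1≤a))

bottom-gap : ∀ {n p q x} → BottomPos n p → BottomPos n q → 1 ≤ x → x ≤ πsize n →
             x < p ⊎ q < x → πval n x < πval n p ⊎ πval n q < πval n x
bottom-gap {n} (a , _ , a≤n , refl) q-bottom@(b , 1≤b , b≤n , refl) 1≤x x≤N side with position n 1≤x x≤N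
... | left            = inj₂ (πval-< (bottom 1≤b b≤n) left (s≤s b≤n))
... | top {c} 1≤c c≤n = inj₂ (πval-< (bottom 1≤b b≤n) (top 1≤c c≤n) (bottom<top c b≤n))
... | right           = inj₂ (πval-< (bottom 1≤b b≤n) right (bottom<right b≤n))
... | bottom 1≤c c≤n with side
...   | inj₁ x<p = inj₁ (πval-<-from-bottom (_ , 1≤c , c≤n , refl) x<p (<⇒≤ (2a<πsize a≤n)))
...   | inj₂ q<x = inj₂ (πval-<-from-bottom q-bottom q<x x≤N)

bottom-right-gap : ∀ {n p x} → BottomPos n p → 1 ≤ x → x < p → x ≢ 1 →
                   πval n x < πval n p ⊎ πval n (πsize n) < πval n x
bottom-right-gap {n} (a , _ , a≤n , refl) 1≤x x<p x≢1 with position n 1≤x (<⇒≤ (<-trans x<p (2a<πsize a≤n)))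
... | left           = contradiction refl x≢1
... | bottom 1≤c c≤n = inj₁ (πval-<-from-bottom (_ , 1≤c , c≤n , refl) x<p (<⇒≤ (2a<πsize a≤n)))
... | top 1≤c c≤n    = inj₂ (πval-< right (top 1≤c c≤n) (right<top n 1≤c))
... | right          = contradiction (2a<πsize a≤n) (<⇒≯ x<p)

Img? : ∀ t g x → Dec (Img t g x)
Img? t g x = map′ from-below to-below (anyUpTo? (λ i → 1 ≤? i ×-dec g i ≟ x) (suc t))
  where
  from-below : (∃ λ i → i < suc t × 1 ≤ i × g i ≡ x) → Img t g x
  from-below (i , s≤s i≤t , 1≤i , gi≡x) = i , 1≤i , i≤t , gi≡x
  to-below : Img t g x → ∃ λ i → i < suc t × 1 ≤ i × g i ≡ x
  to-below (i , 1≤i , i≤t , gi≡x) = i , s≤s i≤t , 1≤i , gi≡x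

replaceAt : (ℕ → ℕ) → ℕ → ℕ → ℕ → ℕ
replaceAt f i y k with k ≟ i
... | yes _ = y
... | no  _ = f k

replaceAt-≡ : ∀ f i y → replaceAt f i y i ≡ y
replaceAt-≡ f i y with i ≟ i
... | yes _   = refl
... | no  i≢i = contradiction refl i≢i

replaceAt-≢ : ∀ f {i} y {l} → l ≢ i → replaceAt f i y l ≡ f l
replaceAt-≢ f {i} y {l} l≢i with l ≟ i
... | yes l≡i = contradiction l≡i l≢i
... | no  _   = refl

replaceAt-not-≤L : ∀ {k f i y} → 1 ≤ i → i ≤ k → f i < y →
  ¬ (LexLess k (replaceAt f i y) f ⊎ (∀ l → 1 ≤ l → l ≤ k → replaceAt f i y l ≡ f l))
replaceAt-not-≤L {f = f} {i} {y} 1≤i i≤k fi<y (inj₂ same) =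
  <-irrefl (sym (trans (sym (replaceAt-≡ f i y)) (same i 1≤i i≤k))) fi<y
replaceAt-not-≤L {f = f} {i} {y} 1≤i i≤k fi<y (inj₁ (l , _ , _ , agree , smaller)) with <-cmp l i
... | tri< l<i _ _  = <-irrefl (replaceAt-≢ f y (<⇒≢ l<i)) smaller
... | tri≈ _ refl _ = <-asym fi<y (subst (_< f l) (replaceAt-≡ f l y) smaller)
... | tri> _ _ i<l  = <-irrefl (sym (trans (sym (replaceAt-≡ f i y)) (agree i 1≤i i<l))) fi<y

replaceAt-compatible : ∀ {k t f g} i {y} → Compatible k f t g → Img t g y → Compatible k (replaceAt f i y) t g
replaceAt-compatible i f⊆g y∈g x (l , 1≤l , l≤k , fl≡x) with l ≟ i
... | yes _ = subst (Img _ _) fl≡x y∈g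
... | no  _ = f⊆g x (l , 1≤l , l≤k , fl≡x)

module _ {k N : ℕ} {σ π f : ℕ → ℕ} (f-emb : IsEmbedding k σ N π f) where

  private
    bounds : ∀ i → 1 ≤ i → i ≤ k → 1 ≤ f i × f i ≤ N
    bounds = proj₁ f-emb

    increasing : ∀ i j → 1 ≤ i → i < j → j ≤ k → f i < f j
    increasing = proj₁ (proj₂ f-emb)

  embedding-≤ : ∀ {i j} → 1 ≤ i → i ≤ j → j ≤ k → f i ≤ f j
  embedding-≤ 1≤i i≤j j≤k with m≤n⇒m<n∨m≡n i≤j
  ... | inj₁ i<j  = <⇒≤ (increasing _ _ 1≤i i<j j≤k)
  ... | inj₂ refl = ≤-refl

  embedding-last : ∀ {i} → 1 ≤ i → i ≤ k → f i ≡ N → i ≡ k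
  embedding-last 1≤i i≤k fi≡N with m≤n⇒m<n∨m≡n i≤k
  ... | inj₂ i≡k = i≡k
  ... | inj₁ i<k = contradiction (proj₂ (bounds k (≤-trans 1≤i i≤k) ≤-refl))
                                 (<⇒≱ (subst (_< f k) fi≡N (increasing _ _ 1≤i i<k ≤-refl)))

  embedding-first : Img k f 1 → f 1 ≡ 1
  embedding-first (l , 1≤l , l≤k , fl≡1) =
    ≤-antisym (subst (f 1 ≤_) fl≡1 (embedding-≤ ≤-refl 1≤l l≤k))
              (proj₁ (bounds 1 ≤-refl (≤-trans 1≤l l≤k)))

  embedding-apart : ∀ {i l y} → 1 ≤ l → l ≤ k → l ≢ i → i ≤ k → (i < k → y < f (suc i)) →
                    f l < f i ⊎ y < f l
  embedding-apart {i} {l} 1≤l l≤k l≢i i≤k y<next with <-cmp l i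
  ... | tri< l<i _ _ = inj₁ (increasing l i 1≤l l<i i≤k)
  ... | tri≈ _ l≡i _ = contradiction l≡i l≢i
  ... | tri> _ _ i<l = inj₂ (<-≤-trans (y<next (<-≤-trans i<l l≤k)) (embedding-≤ z<s i<l l≤k))

  replaceAt-isEmbedding : ∀ {i y} → 1 ≤ i → i ≤ k → f i < y → (i < k → y < f (suc i)) → y ≤ N →
    π (f i) < π y → (∀ l → 1 ≤ l → l ≤ k → l ≢ i → π (f l) < π (f i) ⊎ π y < π (f l)) →
    IsEmbedding k σ N π (replaceAt f i y)
  replaceAt-isEmbedding {i} {y} 1≤i i≤k fi<y y<next y≤N πfi<πy gap = bounds′ , increasing′ , order-iso′
    where
    bounds′ : ∀ l → 1 ≤ l → l ≤ k → 1 ≤ replaceAt f i y l × replaceAt f i y l ≤ N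
    bounds′ l 1≤l l≤k with l ≟ i
    ... | yes refl = ≤-trans (proj₁ (bounds l 1≤l l≤k)) (<⇒≤ fi<y) , y≤N
    ... | no  _    = bounds l 1≤l l≤k

    increasing′ : ∀ l l′ → 1 ≤ l → l < l′ → l′ ≤ k → replaceAt f i y l < replaceAt f i y l′
    increasing′ l l′ 1≤l l<l′ l′≤k with l ≟ i | l′ ≟ i
    ... | yes refl | yes refl = contradiction l<l′ (<-irrefl refl)
    ... | yes refl | no  _    = <-≤-trans (y<next (<-≤-trans l<l′ l′≤k)) (embedding-≤ z<s l<l′ l′≤k)
    ... | no  _    | yes refl = <-trans (increasing l l′ 1≤l l<l′ l′≤k) fi<y
    ... | no  _    | no  _    = increasing l l′ 1≤l l<l′ l′≤k

    order-iso′ : ∀ l l′ → 1 ≤ l → l ≤ k → 1 ≤ l′ → l′ ≤ k →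
      (σ l < σ l′ → π (replaceAt f i y l) < π (replaceAt f i y l′)) ×
      (π (replaceAt f i y l) < π (replaceAt f i y l′) → σ l < σ l′)
    order-iso′ l l′ 1≤l l≤k 1≤l′ l′≤k
      with l ≟ i | l′ ≟ i | proj₂ (proj₂ f-emb) l l′ 1≤l l≤k 1≤l′ l′≤k
    ... | yes refl | yes refl | _ = (λ σl<σl → contradiction σl<σl (<-irrefl refl)) ,
                                    (λ πy<πy → contradiction πy<πy (<-irrefl refl))
    ... | yes refl | no  l′≢i | preserve , reflect =
      (λ σl<σl′ → [ (λ below → contradiction below (<-asym (preserve σl<σl′))) , id ]′
                    (gap l′ 1≤l′ l′≤k l′≢i)) ,
      (λ πy<πfl′ → reflect (<-trans πfi<πy πy<πfl′))
    ... | no  l≢i | yes refl | preserve , reflect =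
      (λ σl<σl′ → <-trans (preserve σl<σl′) πfi<πy) ,
      (λ πfl<πy → [ reflect , (λ above → contradiction above (<-asym πfl<πy)) ]′ (gap l 1≤l l≤k l≢i))
    ... | no  _    | no  _    | iso = iso

rightmost-first-≤ : ∀ {n m la t g f f′} → Rightmost n m la t g f → 1 ≤ m →
  IsEmbedding m la (πsize n) (πval n) f′ → Compatible m f′ t g → f′ 1 ≤ f 1
rightmost-first-≤ (_ , _ , maximal) 1≤m f′-emb f′⊆g with maximal _ f′-emb f′⊆g
... | inj₂ same                               = ≤-reflexive (same 1 ≤-refl 1≤m)
... | inj₁ (suc zero , _ , _ , _ , smaller)   = <⇒≤ smaller
... | inj₁ (suc (suc j) , _ , _ , agree , _) = ≤-reflexive (agree 1 ≤-refl (s≤s z<s))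

bot<top : ∀ {m la k l} → ExactlyOneInvDescent m la → BotPosOf m la l → TopPosOf m la k → la l < la k
bot<top {la = la} {k} (_ , _ , _ , unique) (_ , _ , i , j , d , ll≤lj) (_ , _ , i′ , j′ , d′ , li′≤lk)
  with unique i j d | unique i′ j′ d′
... | refl , refl | refl , refl = ≤-trans (s≤s ll≤lj) (subst (_≤ la k) (proj₂ (proj₂ (proj₂ d))) li′≤lk)

top⊎bot : ∀ {m la k} → ExactlyOneInvDescent m la → 1 ≤ k → k ≤ m → TopPosOf m la k ⊎ BotPosOf m la k
top⊎bot {la = la} {k} (i₀ , j₀ , descent , _) 1≤k k≤m with la i₀ ≤? la k
... | yes li₀≤lk = inj₁ (1≤k , k≤m , i₀ , j₀ , descent , li₀≤lk)
... | no  li₀≰lk = inj₂ (1≤k , k≤m , i₀ , j₀ , descent ,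
                         ≤-pred (subst (la k <_) (proj₂ (proj₂ (proj₂ descent))) (≰⇒> li₀≰lk)))

greedyIn-⊆ : ∀ {n m la S h} → ExactlyOneInvDescent m la → GreedyIn n m la S h →
             ∀ k → 1 ≤ k → k ≤ m → S (h k)
greedyIn-⊆ one-descent ((last , _) , tops , bottoms) k 1≤k k≤m with m≤n⇒m<n∨m≡n k≤m
... | inj₂ refl = proj₂ last
... | inj₁ k<m with top⊎bot one-descent 1≤k k≤m
...   | inj₁ tp = proj₁ (proj₂ (proj₁ (tops k 1≤k (<⇒≤∸1 k<m) tp)))
...   | inj₂ bp = proj₁ (proj₂ (proj₁ (bottoms k 1≤k (<⇒≤∸1 k<m) bp)))

module FirstTopLastBottom {m} {la : ℕ → ℕ} (one-descent : ExactlyOneInvDescent m la)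
                          (top-1 : TopPosOf m la 1) (bot-m : BotPosOf m la m) where

  1≤m : 1 ≤ m
  1≤m = ≤-trans (proj₁ top-1) (proj₁ (proj₂ top-1))

  top≢m : ∀ {k} → TopPosOf m la k → k ≢ m
  top≢m tp refl = <-irrefl refl (bot<top one-descent bot-m tp)

  1<bot : ∀ {k} → BotPosOf m la k → 1 < k
  1<bot bp@(1≤k , _) = ≤∧≢⇒< 1≤k λ { refl → <-irrefl refl (bot<top one-descent bp top-1) }

  module _ {n f} (f-emb : IsEmbedding m la (πsize n) (πval n) f) where

    private
      bounds : ∀ k → 1 ≤ k → k ≤ m → 1 ≤ f k × f k ≤ πsize n
      bounds = proj₁ f-emb

      increasing : ∀ k l → 1 ≤ k → k < l → l ≤ m → f k < f l
      increasing = proj₁ (proj₂ f-emb)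

      reflect : ∀ {k l} → 1 ≤ k → k ≤ m → 1 ≤ l → l ≤ m → πval n (f k) < πval n (f l) → la k < la l
      reflect 1≤k k≤m 1≤l l≤m = proj₂ (proj₂ (proj₂ f-emb) _ _ 1≤k k≤m 1≤l l≤m)

      image-kind : ∀ {k} → 1 ≤ k → k ≤ m →
                   (LeftPos (f k) ⊎ TopPos n (f k)) ⊎ (BottomPos n (f k) ⊎ RightPos n (f k))
      image-kind 1≤k k≤m = uncurry (leftTop⊎bottomRight n) (bounds _ 1≤k k≤m)

      last-only : ∀ {k} → 1 ≤ k → k ≤ m → f k ≡ πsize n → k ≡ m
      last-only = embedding-last {σ = la} {π = πval n} f-emb

    top-image : ∀ {k} → TopPosOf m la k → LeftPos (f k) ⊎ TopPos n (f k)
    top-image {k} tp@(1≤k , k≤m , _) with image-kind 1≤k k≤m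
    ... | inj₁ leftTop          = leftTop
    ... | inj₂ (inj₂ fk-right)  = contradiction (last-only 1≤k k≤m fk-right) (top≢m tp)
    ... | inj₂ (inj₁ fk-bottom) =
      contradiction (bot<top one-descent bot-m tp) (<-asym (reflect 1≤k k≤m 1≤m ≤-refl
        (πval-<-from-bottom fk-bottom (increasing k m 1≤k (≤∧≢⇒< k≤m (top≢m tp)) ≤-refl)
                                      (proj₂ (bounds m 1≤m ≤-refl)))))

    bottom-image : ∀ {k} → BotPosOf m la k → BottomPos n (f k) ⊎ RightPos n (f k)
    bottom-image {k} bp@(1≤k , k≤m , _) with image-kind 1≤k k≤m
    ... | inj₂ bottomRight = bottomRight
    ... | inj₁ (inj₁ fk≡1) =
      contradiction (subst (f 1 <_) fk≡1 (increasing 1 k ≤-refl (1<bot bp) k≤m))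
                    (≤⇒≯ (proj₁ (bounds 1 ≤-refl 1≤m)))
    ... | inj₁ (inj₂ fk-top) =
      contradiction (bot<top one-descent bp top-1) (<-asym (reflect ≤-refl 1≤m 1≤k k≤m
        (πval-<-to-top fk-top (proj₁ (bounds 1 ≤-refl 1≤m)) (increasing 1 k ≤-refl (1<bot bp) k≤m))))

    bottom-image-<m : ∀ {k} → BotPosOf m la k → k < m → BottomPos n (f k)
    bottom-image-<m bp@(1≤k , k≤m , _) k<m with bottom-image bp
    ... | inj₁ fk-bottom = fk-bottom
    ... | inj₂ fk-right  = contradiction (last-only 1≤k k≤m fk-right) (<⇒≢ k<m)

    left-excludes-right : Img m f 1 → ¬ Img m f (πsize n)
    left-excludes-right 1∈f (l , 1≤l , l≤m , fl≡N) with last-only 1≤l l≤m fl≡N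
    ... | refl = <-asym (bot<top one-descent bot-m top-1) (reflect ≤-refl 1≤m 1≤m ≤-refl
                   (subst₂ (λ x y → πval n x < πval n y)
                           (sym (embedding-first {σ = la} {π = πval n} f-emb 1∈f)) (sym fl≡N) (πval-left<right n)))

module RightmostEmbedding {n m t} {la g f : ℕ → ℕ} (one-descent : ExactlyOneInvDescent m la)
                          (top-1 : TopPosOf m la 1) (bot-m : BotPosOf m la m)
                          (rm : Rightmost n m la t g f) where

  open FirstTopLastBottom one-descent top-1 bot-m

  private
    f-emb : IsEmbedding m la (πsize n) (πval n) f
    f-emb = proj₁ rm

    increasing : ∀ k l → 1 ≤ k → k < l → l ≤ m → f k < f l
    increasing = proj₁ (proj₂ f-emb)

    1≤f : ∀ {l} → 1 ≤ l → l ≤ m → 1 ≤ f l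
    1≤f 1≤l l≤m = proj₁ (proj₁ f-emb _ 1≤l l≤m)

    f≤N : ∀ {l} → 1 ≤ l → l ≤ m → f l ≤ πsize n
    f≤N 1≤l l≤m = proj₂ (proj₁ f-emb _ 1≤l l≤m)

    apart : ∀ {i l y} → 1 ≤ l → l ≤ m → l ≢ i → i ≤ m → (i < m → y < f (suc i)) →
            f l < f i ⊎ y < f l
    apart = embedding-apart {σ = la} {π = πval n} f-emb

    f∈g : ∀ i → 1 ≤ i → i ≤ m → Img t g (f i)
    f∈g i 1≤i i≤m = proj₁ (proj₂ rm) (f i) (i , 1≤i , i≤m , refl)

    past-last : ∀ {y} → m < m → y < f (suc m)
    past-last m<m = contradiction m<m (n≮n m)

  ValuesAvoid : ℕ → ℕ → Set
  ValuesAvoid i y = ∀ l → 1 ≤ l → l ≤ m → l ≢ i → πval n (f l) < πval n (f i) ⊎ πval n y < πval n (f l)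

  cannot-raise : ∀ {i y} → 1 ≤ i → i ≤ m → (i < m → y < f (suc i)) → y ≤ πsize n → Img t g y →
                 πval n (f i) < πval n y → ValuesAvoid i y → ¬ f i < y
  cannot-raise {i} 1≤i i≤m y<next y≤N y∈g πfi<πy gap fi<y =
    replaceAt-not-≤L 1≤i i≤m fi<y
      (proj₂ (proj₂ rm) _ (replaceAt-isEmbedding f-emb 1≤i i≤m fi<y y<next y≤N πfi<πy gap)
                          (replaceAt-compatible i (proj₁ (proj₂ rm)) y∈g))

  cannot-raise-top : ∀ {i y} → TopPosOf m la i → i < m → LeftPos y ⊎ TopPos n y → Img t g y →
                     y < f (suc i) → ¬ f i < y
  cannot-raise-top (1≤i , _) i<m (inj₁ refl) _ _ fi<1 = contradiction fi<1 (≤⇒≯ (1≤f 1≤i (<⇒≤ i<m)))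
  cannot-raise-top {i} {y} tp@(1≤i , _) i<m (inj₂ y-top) y∈g y<next fi<y =
    cannot-raise 1≤i (<⇒≤ i<m) (λ _ → y<next) (≤-trans (<⇒≤ y<next) (f≤N z<s i<m)) y∈g
      (πval-<-to-top y-top (1≤f 1≤i (<⇒≤ i<m)) fi<y) gap fi<y
    where
    gap : ValuesAvoid i y
    gap l 1≤l l≤m l≢i = top-gap (top-image f-emb tp) y-top (1≤f 1≤l l≤m) (f≤N 1≤l l≤m)
      (apart 1≤l l≤m l≢i (<⇒≤ i<m) (λ _ → y<next))
      (λ { (fi≡1 , fl≡N) → left-excludes-right f-emb (i , 1≤i , <⇒≤ i<m , fi≡1) (l , 1≤l , l≤m , fl≡N) })

  cannot-raise-bottom : ∀ {i y} → BotPosOf m la i → i < m → BottomPos n y → Img t g y →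
                        y < f (suc i) → ¬ f i < y
  cannot-raise-bottom {i} {y} bp@(1≤i , _) i<m y-bottom y∈g y<next fi<y =
    cannot-raise 1≤i (<⇒≤ i<m) (λ _ → y<next) y≤N y∈g (πval-<-from-bottom fi-bottom fi<y y≤N) gap fi<y
    where
    y≤N : y ≤ πsize n
    y≤N = ≤-trans (<⇒≤ y<next) (f≤N z<s i<m)
    fi-bottom : BottomPos n (f i)
    fi-bottom = bottom-image-<m f-emb bp i<m
    gap : ValuesAvoid i y
    gap l 1≤l l≤m l≢i = bottom-gap fi-bottom y-bottom (1≤f 1≤l l≤m) (f≤N 1≤l l≤m)
      (apart 1≤l l≤m l≢i (<⇒≤ i<m) (λ _ → y<next))

  cannot-raise-last-to-bottom : ∀ {y} → BottomPos n y → Img t g y → ¬ f m < y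
  cannot-raise-last-to-bottom {y} y-bottom@(_ , _ , b≤n , refl) y∈g fm<y with bottom-image f-emb bot-m
  ... | inj₂ fm≡N = contradiction (subst (_< y) fm≡N fm<y) (<⇒≯ (2a<πsize b≤n))
  ... | inj₁ fm-bottom =
    cannot-raise 1≤m ≤-refl past-last (<⇒≤ (2a<πsize b≤n)) y∈g
      (πval-<-from-bottom fm-bottom fm<y (<⇒≤ (2a<πsize b≤n))) gap fm<y
    where
    gap : ValuesAvoid m y
    gap l 1≤l l≤m l≢m = bottom-gap fm-bottom y-bottom (1≤f 1≤l l≤m) (f≤N 1≤l l≤m)
      (apart 1≤l l≤m l≢m ≤-refl past-last)

  cannot-raise-last-to-right : ¬ Img m f 1 → Img t g (πsize n) → ¬ f m < πsize n
  cannot-raise-last-to-right 1∉f N∈g fm<N with bottom-image f-emb bot-m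
  ... | inj₂ fm≡N = <-irrefl fm≡N fm<N
  ... | inj₁ fm-bottom =
    cannot-raise 1≤m ≤-refl past-last ≤-refl N∈g (πval-<-from-bottom fm-bottom fm<N ≤-refl) gap fm<N
    where
    gap : ValuesAvoid m (πsize n)
    gap l 1≤l l≤m l≢m =
      bottom-right-gap fm-bottom (1≤f 1≤l l≤m) (increasing l m 1≤l (≤∧≢⇒< l≤m l≢m) ≤-refl)
      (λ fl≡1 → 1∉f (l , 1≤l , l≤m , fl≡1))

  greedy-in : (S : ℕ → Set) → (∀ i → 1 ≤ i → i ≤ m → S (f i)) → (∀ j → S j → Img t g j) →
              (S (πsize n) → ¬ f m < πsize n) → GreedyIn n m la S f
  greedy-in S f∈S S⊆g right-blocked = last , tops , bottoms
    where
    last : IsLargest (λ j → (BottomPos n j ⊎ RightPos n j) × S j) (f m)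
    last = (bottom-image f-emb bot-m , f∈S m 1≤m ≤-refl) , beaten
      where
      beaten : ∀ y → (BottomPos n y ⊎ RightPos n y) × S y → y ≤ f m
      beaten y (inj₁ y-bottom , y∈S) = ≮⇒≥ (cannot-raise-last-to-bottom y-bottom (S⊆g y y∈S))
      beaten y (inj₂ refl     , y∈S) = ≮⇒≥ (right-blocked y∈S)

    tops : ∀ i → 1 ≤ i → i ≤ m ∸ 1 → TopPosOf m la i →
           IsLargest (λ j → (LeftPos j ⊎ TopPos n j) × S j × j < f (suc i)) (f i)
    tops i 1≤i i≤m-1 tp =
      (top-image f-emb tp , f∈S i 1≤i (<⇒≤ i<m) , increasing i (suc i) 1≤i ≤-refl i<m) ,
      λ { y (y-kind , y∈S , y<next) → ≮⇒≥ (cannot-raise-top tp i<m y-kind (S⊆g y y∈S) y<next) }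
      where
      i<m : i < m
      i<m = ≤∸1⇒< 1≤i i≤m-1

    bottoms : ∀ i → 1 ≤ i → i ≤ m ∸ 1 → BotPosOf m la i →
              IsLargest (λ j → BottomPos n j × S j × j < f (suc i)) (f i)
    bottoms i 1≤i i≤m-1 bp =
      (bottom-image-<m f-emb bp i<m , f∈S i 1≤i (<⇒≤ i<m) , increasing i (suc i) 1≤i ≤-refl i<m) ,
      λ { y (y-bottom , y∈S , y<next) → ≮⇒≥ (cannot-raise-bottom bp i<m y-bottom (S⊆g y y∈S) y<next) }
      where
      i<m : i < m
      i<m = ≤∸1⇒< 1≤i i≤m-1

  Img⁻ : ℕ → Set
  Img⁻ j = Img t g j × j ≢ πsize n

  greedy-or-almost-greedy : Greedy n m la t g f ⊎ AlmostGreedy n m la t g f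
  greedy-or-almost-greedy with Img? m f 1 | Img? t g (πsize n)
  ... | no 1∉f  | _       = inj₁ (greedy-in (Img t g) f∈g (λ _ → id) (cannot-raise-last-to-right 1∉f))
  ... | yes _   | no N∉g  = inj₁ (greedy-in (Img t g) f∈g (λ _ → id) (λ N∈g → contradiction N∈g N∉g))
  ... | yes 1∈f | yes N∈g =
    inj₂ (N∈g , greedy-in Img⁻ f∈g⁻ (λ _ → proj₁) (λ N∈g⁻ → contradiction refl (proj₂ N∈g⁻)))
    where
    f∈g⁻ : ∀ i → 1 ≤ i → i ≤ m → Img⁻ (f i)
    f∈g⁻ i 1≤i i≤m = f∈g i 1≤i i≤m , λ fi≡N → left-excludes-right f-emb 1∈f (i , 1≤i , i≤m , fi≡N)

  almost-greedy⇒left : AlmostGreedy n m la t g f → Img m f 1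
  almost-greedy⇒left (N∈g , ((_ , _ , fm≢N) , _) , _) =
    decidable-stable (Img? m f 1)
      λ 1∉f → cannot-raise-last-to-right 1∉f N∈g (≤∧≢⇒< (f≤N 1≤m ≤-refl) fm≢N)

  compatible-left-not-right : Img m f 1 →
    ∀ f′ → IsEmbedding m la (πsize n) (πval n) f′ → Compatible m f′ t g → Img m f′ 1 × ¬ Img m f′ (πsize n)
  compatible-left-not-right 1∈f f′ f′-emb f′⊆g = 1∈f′ , left-excludes-right f′-emb 1∈f′
    where
    f′1≡1 : f′ 1 ≡ 1
    f′1≡1 = ≤-antisym (subst (f′ 1 ≤_) (embedding-first {σ = la} {π = πval n} f-emb 1∈f)
                             (rightmost-first-≤ rm 1≤m f′-emb f′⊆g))
                      (proj₁ (proj₁ f′-emb 1 ≤-refl 1≤m))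
    1∈f′ : Img m f′ 1
    1∈f′ = 1 , ≤-refl , 1≤m , f′1≡1

  no-greedy : Img m f 1 → Img t g (πsize n) →
              ¬ (Σ (ℕ → ℕ) λ h → IsEmbedding m la (πsize n) (πval n) h × Greedy n m la t g h)
  no-greedy 1∈f N∈g (h , h-emb , h-greedy@((_ , h-last-largest) , _)) =
    proj₂ (compatible-left-not-right 1∈f h h-emb h⊆g) (m , 1≤m , ≤-refl , hm≡N)
    where
    hm≡N : h m ≡ πsize n
    hm≡N = ≤-antisym (proj₂ (proj₁ h-emb m 1≤m ≤-refl)) (h-last-largest (πsize n) (inj₂ refl , N∈g))
    h⊆g : Compatible m h t g
    h⊆g x (k , 1≤k , k≤m , hk≡x) = subst (Img t g) hk≡x (greedyIn-⊆ one-descent h-greedy k 1≤k k≤m)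

lemma22 : (n : ℕ) → 2 ≤ n →
    (m : ℕ) (la : ℕ → ℕ) → Proper n m la →
    (t : ℕ) (τ : ℕ → ℕ) → IsPerm t τ →
    Contained m la t τ → Contained t τ (πsize n) (πval n) →
    (g : ℕ → ℕ) → IsEmbedding t τ (πsize n) (πval n) g →
    (f : ℕ → ℕ) → Rightmost n m la t g f →
    (Greedy n m la t g f ⊎ AlmostGreedy n m la t g f) ×
    (AlmostGreedy n m la t g f →
      (∀ f' → IsEmbedding m la (πsize n) (πval n) f' → Compatible m f' t g →
         Img m f' 1 × ¬ Img m f' (πsize n)) ×
      ¬ (Σ (ℕ → ℕ) λ h → IsEmbedding m la (πsize n) (πval n) h × Greedy n m la t g h))
lemma22 n _ m la (_ , _ , _ , one-descent , (top-1 , _ , _ , bot-m) , _) t _ _ _ _ g _ f rm =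
  greedy-or-almost-greedy ,
  λ almost → compatible-left-not-right (almost-greedy⇒left almost) ,
             no-greedy (almost-greedy⇒left almost) (proj₁ almost)
  where open RightmostEmbedding one-descent top-1 bot-m rm
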